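{- Let $u$ be an odd prime and let $(x,y,z,n)$ be an exceptional solution of $[(u^2-4)n]^x+(4un)^y=[(u^2+4)n]^z$ whose associated $u_1$ satisfies $u_1\equiv 5\pmod 8$, and let $w$ be the positive integer with $u_2=w^{2^s}$, $s=\nu_2(z-x)-\nu_2(x)$. Then $\left(\frac{n}{p}\right)=\left(\frac{w}{p}\right)$ for every odd prime $p$.
   Context: Let $u$ be an odd prime. A solution $(x,y,z,n)$ in positive integers is exceptional if $n>1$ and $(x,y,z)\ne(2,2,2)$. It is known that every exceptional solution satisfies $y>z>x$, $\gcd(n,u^2+4)=1$, and there are unique coprime positive integers $u_1,u_2$ with $u_1u_2=u^2-4$, $(u^2+4)^z-(4u)^yn^{y-z}=u_1^x$ and $n^{z-x}=u_2^x$. When $u_1\equiv 5\pmod 8$ one has $\nu_2(z)=\nu_2(x)$ and $u_2=w^{2^s}$ for a unique positive integer $w$, where $s=\nu_2(z-x)-\nu_2(x)$. $\nu_2(t)$ is the exponent of $2$ in $t$; $\left(\frac{\cdot}{p}\right)$ is the Legendre symbol. -}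

module Defs where

open import Data.Nat using (ℕ; zero; suc; _*_; _%_; _/_; _≟_; NonZero)
open import Data.Nat.Divisibility using (_∣?_)
open import Data.List using (upTo)
open import Data.List.Relation.Unary.Any using (any?)
open import Data.Integer using (ℤ; +_; -[1+_])
open import Relation.Nullary using (yes; no)

-- 2-adic valuation ν₂ t : exponent of 2 in t (convention ν₂ 0 = 0; only used at t > 0).
ν₂-aux : ℕ → ℕ → ℕ
ν₂-aux zero    t = 0
ν₂-aux (suc f) zero = 0
ν₂-aux (suc f) (suc t) with (suc t) % 2 ≟ 0
... | yes _ = suc (ν₂-aux f ((suc t) / 2))
... | no  _ = 0

ν₂ : ℕ → ℕ
ν₂ t = ν₂-aux t t

legendre : ℕ → (p : ℕ) → .{{_ : NonZero p}} → ℤ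
legendre a p with p ∣? a
... | yes _ = + 0
... | no  _ with any? (λ t → (t * t) % p ≟ a % p) (upTo p)
...   | yes _ = + 1
...   | no  _ = -[1+ 0 ]

{-# OPTIONS --safe #-}
-- Write z ∸ x = 2^a d and x = 2^b e with d, e odd.  If b ≤ a, then
-- n^(z∸x) = u₂^x = w^(2^(a∸b) x) reads (n^d)^(2^a) = (w^e)^(2^a), so n^d = w^e;
-- and an odd power c^(2j+1) has the Legendre symbol of c, since modulo p a
-- square root of c^(2j+1) times the inverse of c^j is a square root of c.
-- The case b > a is impossible: then z = 2^a · odd, and u² + 4 ≡ u₁ ≡ 5 (mod 8)
-- gives (u² + 4)^z ≡ 1 + 2^(a+2) and u₁^x ≡ 1 modulo 2^(a+3), which divides the
-- remaining term (4u)^y n^(y∸z).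
module Submission where

open import Defs
open import Data.Nat
open import Data.Nat.Properties
open import Data.Nat.DivMod
open import Data.Nat.Divisibility
open import Data.Nat.Primality
open import Data.Nat.Coprimality using (Coprime; coprime-Bézout; prime⇒coprime)
import Data.Nat.Coprimality as Coprimality
open import Data.Nat.GCD using (module Bézout)
open import Data.Nat.Tactic.RingSolver using (solve-∀)
open import Data.Product using (_×_; ∃-syntax; _,_; proj₁; proj₂)
open import Data.Sum using (inj₁; inj₂)
open import Data.Empty using (⊥-elim)
open import Data.List using (upTo)
open import Data.List.Relation.Unary.Any using (Any; any?; satisfied)
open import Data.List.Membership.Propositional using (lose)
open import Data.List.Membership.Propositional.Properties using (∈-upTo⁺)
open import Function using (_⇔_; mk⇔; Equivalence; _∘_)
open import Relation.Nullary using (¬_; yes; no)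
open import Relation.Binary.PropositionalEquality
  using (_≡_; _≢_; refl; sym; trans; cong; cong₂; subst; module ≡-Reasoning)
open import Relation.Binary.Definitions using (tri<; tri≈; tri>)

open Equivalence using (to; from)

^-distribʳ-* : ∀ m n k → (m * n) ^ k ≡ m ^ k * n ^ k
^-distribʳ-* m n zero    = refl
^-distribʳ-* m n (suc k) = trans (cong (m * n *_) (^-distribʳ-* m n k)) (swap m n (m ^ k) (n ^ k))
  where
  swap : ∀ a b c d → a * b * (c * d) ≡ a * c * (b * d)
  swap = solve-∀

^-*-split : ∀ m {i j} o → i ≤ j → m ^ j * o ≡ m ^ i * (m ^ (j ∸ i) * o)
^-*-split m {i} {j} o i≤j = begin
  m ^ j * o                   ≡⟨ cong (λ k → m ^ k * o) (sym (m+[n∸m]≡n i≤j)) ⟩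
  m ^ (i + (j ∸ i)) * o       ≡⟨ cong (_* o) (^-distribˡ-+-* m i (j ∸ i)) ⟩
  m ^ i * m ^ (j ∸ i) * o     ≡⟨ *-assoc (m ^ i) _ o ⟩
  m ^ i * (m ^ (j ∸ i) * o)   ∎
  where open ≡-Reasoning

^-odd : ∀ c j → c ^ suc (2 * j) ≡ c * (c ^ j * c ^ j)
^-odd c j = cong (c *_) (trans (^-distribˡ-+-* c j (j + 0)) (cong (λ k → c ^ j * c ^ k) (+-identityʳ j)))

^-2^-suc : ∀ m c → m ^ 2 ^ suc c ≡ m ^ 2 ^ c * m ^ 2 ^ c
^-2^-suc m c = trans (cong (λ k → m ^ (2 ^ c + k)) (+-identityʳ (2 ^ c))) (^-distribˡ-+-* m (2 ^ c) (2 ^ c))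

m^i∣m^j : ∀ m {i j} → i ≤ j → m ^ i ∣ m ^ j
m^i∣m^j m {i} {j} i≤j = divides (m ^ (j ∸ i)) (begin
  m ^ j                  ≡⟨ cong (m ^_) (sym (m+[n∸m]≡n i≤j)) ⟩
  m ^ (i + (j ∸ i))      ≡⟨ ^-distribˡ-+-* m i (j ∸ i) ⟩
  m ^ i * m ^ (j ∸ i)    ≡⟨ *-comm (m ^ i) _ ⟩
  m ^ (j ∸ i) * m ^ i    ∎)
  where open ≡-Reasoning

^-injectiveˡ : ∀ k .{{_ : NonZero k}} {a b} → a ^ k ≡ b ^ k → a ≡ b
^-injectiveˡ k {a} {b} eq with <-cmp a b
... | tri≈ _ a≡b _ = a≡b
... | tri< a<b _ _ = ⊥-elim (<-irrefl eq (^-monoˡ-< k a<b))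
... | tri> _ _ b<a = ⊥-elim (<-irrefl (sym eq) (^-monoˡ-< k b<a))

n<2^n : ∀ n → n < 2 ^ n
n<2^n zero    = s≤s z≤n
n<2^n (suc n) = +-mono-≤ (m^n>0 2 n) (≤-trans (n<2^n n) (m≤m+n (2 ^ n) 0))

prime∣^⇒prime∣ : ∀ {p} m k → Prime p → p ∣ m ^ k → p ∣ m
prime∣^⇒prime∣ m zero    pp p∣1 = ⊥-elim (nonTrivial⇒≢1 {{prime⇒nonTrivial pp}} (∣1⇒≡1 p∣1))
prime∣^⇒prime∣ m (suc k) pp p∣m*mᵏ with euclidsLemma m (m ^ k) pp p∣m*mᵏ
... | inj₁ p∣m  = p∣m
... | inj₂ p∣mᵏ = prime∣^⇒prime∣ m k pp p∣mᵏ

infix 4 _≡_[mod_]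
_≡_[mod_] : ℕ → ℕ → (m : ℕ) → .{{_ : NonZero m}} → Set
a ≡ b [mod m ] = a % m ≡ b % m

IsSquareMod : ℕ → (m : ℕ) → .{{_ : NonZero m}} → Set
IsSquareMod a m = ∃[ t ] t * t ≡ a [mod m ]

module _ {m : ℕ} .{{_ : NonZero m}} where

  *-cong-mod : ∀ {a b c d} → a ≡ b [mod m ] → c ≡ d [mod m ] → a * c ≡ b * d [mod m ]
  *-cong-mod {a} {b} {c} {d} a≡b c≡d = begin
    a * c % m                 ≡⟨ %-distribˡ-* a c m ⟩
    (a % m) * (c % m) % m     ≡⟨ cong₂ (λ s t → s * t % m) a≡b c≡d ⟩
    (b % m) * (d % m) % m     ≡⟨ sym (%-distribˡ-* b d m) ⟩
    b * d % m                 ∎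
    where open ≡-Reasoning

  *-congˡ-mod : ∀ c {a b} → a ≡ b [mod m ] → c * a ≡ c * b [mod m ]
  *-congˡ-mod c a≡b = *-cong-mod {c} {c} refl a≡b

  *-congʳ-mod : ∀ c {a b} → a ≡ b [mod m ] → a * c ≡ b * c [mod m ]
  *-congʳ-mod c a≡b = *-cong-mod a≡b (refl {x = c % m})

  isSquareMod⇔any : ∀ a → IsSquareMod a m ⇔ Any (λ t → t * t % m ≡ a % m) (upTo m)
  isSquareMod⇔any a = mk⇔
    (λ (t , t²≡a) → lose (∈-upTo⁺ (m%n<n t m))
                      (trans (*-cong-mod (m%n%n≡m%n t m) (m%n%n≡m%n t m)) t²≡a))
    satisfied

  legendre-cong : ∀ a b → (m ∣ a ⇔ m ∣ b) → (¬ m ∣ a → IsSquareMod a m ⇔ IsSquareMod b m) →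
                  legendre a m ≡ legendre b m
  legendre-cong a b m∣a⇔m∣b squares with m ∣? a | m ∣? b
  ... | yes _    | yes _    = refl
  ... | yes m∣a  | no  m∤b  = ⊥-elim (m∤b (to m∣a⇔m∣b m∣a))
  ... | no  m∤a  | yes m∣b  = ⊥-elim (m∤a (from m∣a⇔m∣b m∣b))
  ... | no  m∤a  | no  _
    with any? (λ t → t * t % m ≟ a % m) (upTo m) | any? (λ t → t * t % m ≟ b % m) (upTo m)
  ... | yes _  | yes _  = refl
  ... | no  _  | no  _  = refl
  ... | yes sa | no ¬sb =
    ⊥-elim (¬sb (to (isSquareMod⇔any b) (to (squares m∤a) (from (isSquareMod⇔any a) sa))))
  ... | no ¬sa | yes sb =
    ⊥-elim (¬sa (to (isSquareMod⇔any a) (from (squares m∤a) (from (isSquareMod⇔any b) sb))))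

module _ {p : ℕ} (prime : Prime p) where

  private instance
    p≢0 : NonZero p
    p≢0 = prime⇒nonZero prime

  inverse-mod : ∀ c → ¬ p ∣ c → ∃[ e ] c * e ≡ 1 [mod p ]
  inverse-mod c p∤c
    with coprime-Bézout (Coprimality.sym (prime⇒coprime prime {{c%p≢0}} (m%n<n c p)))
    where
    c%p≢0 : NonZero (c % p)
    c%p≢0 = ≢-nonZero (λ c%p≡0 → p∤c (m%n≡0⇒n∣m c p c%p≡0))
  ... | Bézout.+- x y 1+yp≡xc = x , (begin
    c * x % p               ≡⟨ *-congʳ-mod x {c} {c % p} (sym (m%n%n≡m%n c p)) ⟩
    c % p * x % p           ≡⟨ cong (_% p) (*-comm (c % p) x) ⟩
    x * (c % p) % p         ≡⟨ cong (_% p) (sym 1+yp≡xc) ⟩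
    (1 + y * p) % p         ≡⟨ [m+kn]%n≡m%n 1 y p ⟩
    1 % p                   ∎)
    where open ≡-Reasoning
  -- Here x·c ≡ −1, so x²c is an inverse: c · x²c = (x c)² = (y p − 1)².
  ... | Bézout.-+ x y 1+xc≡yp = x * x * c′ , (begin
    c * (x * x * c′) % p             ≡⟨ *-congʳ-mod (x * x * c′) {c} {c′} (sym (m%n%n≡m%n c p)) ⟩
    c′ * (x * x * c′) % p            ≡⟨ cong (_% p) (square c′ x) ⟩
    xc * xc % p                      ≡⟨ sym ([m+kn]%n≡m%n (xc * xc) (2 * y) p) ⟩
    (xc * xc + 2 * y * p) % p        ≡⟨ cong (_% p) key ⟩
    (1 + y * y * p * p) % p          ≡⟨ [m+kn]%n≡m%n 1 (y * y * p) p ⟩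
    1 % p                            ∎)
    where
    open ≡-Reasoning
    c′ = c % p
    xc = x * c′
    square : ∀ c x → c * (x * x * c) ≡ x * c * (x * c)
    square = solve-∀
    key : xc * xc + 2 * y * p ≡ 1 + y * y * p * p
    key = begin
      xc * xc + 2 * y * p              ≡⟨ *-assoc-2 xc y p ⟩
      xc * xc + 2 * (y * p)            ≡⟨ cong (λ t → xc * xc + 2 * t) (sym 1+xc≡yp) ⟩
      xc * xc + 2 * (1 + xc)           ≡⟨ complete-square xc ⟩
      1 + (1 + xc) * (1 + xc)          ≡⟨ cong (λ t → 1 + t * t) 1+xc≡yp ⟩
      1 + y * p * (y * p)              ≡⟨ regroup y p ⟩
      1 + y * y * p * p                ∎
      where
      *-assoc-2 : ∀ s y p → s * s + 2 * y * p ≡ s * s + 2 * (y * p)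
      *-assoc-2 = solve-∀
      complete-square : ∀ s → s * s + 2 * (1 + s) ≡ 1 + (1 + s) * (1 + s)
      complete-square = solve-∀
      regroup : ∀ y p → 1 + y * p * (y * p) ≡ 1 + y * y * p * p
      regroup = solve-∀

  isSquareMod-^-odd : ∀ c j → ¬ p ∣ c → IsSquareMod (c ^ suc (2 * j)) p ⇔ IsSquareMod c p
  isSquareMod-^-odd c j p∤c = mk⇔ root power
    where
    q = c ^ j
    power : IsSquareMod c p → IsSquareMod (c ^ suc (2 * j)) p
    power (t , t²≡c) = t * q , (begin
      t * q * (t * q) % p      ≡⟨ cong (_% p) (interchange t q) ⟩
      t * t * (q * q) % p      ≡⟨ *-congʳ-mod (q * q) {t * t} {c} t²≡c ⟩
      c * (q * q) % p          ≡⟨ cong (_% p) (sym (^-odd c j)) ⟩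
      c ^ suc (2 * j) % p      ∎)
      where
      open ≡-Reasoning
      interchange : ∀ t q → t * q * (t * q) ≡ t * t * (q * q)
      interchange = solve-∀
    root : IsSquareMod (c ^ suc (2 * j)) p → IsSquareMod c p
    root (s , s²≡cᵒ) with inverse-mod q (p∤c ∘ prime∣^⇒prime∣ c j prime)
    ... | e , qe≡1 = s * e , (begin
      s * e * (s * e) % p          ≡⟨ cong (_% p) (interchange s e) ⟩
      s * s * (e * e) % p          ≡⟨ *-congʳ-mod (e * e) {s * s} {c ^ suc (2 * j)} s²≡cᵒ ⟩
      c ^ suc (2 * j) * (e * e) % p ≡⟨ cong (λ t → t * (e * e) % p) (^-odd c j) ⟩
      c * (q * q) * (e * e) % p    ≡⟨ cong (_% p) (regroup c q e) ⟩
      c * (q * e) * (q * e) % p    ≡⟨ *-cong-mod {a = c * (q * e)} {b = c * 1}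
                                          (*-congˡ-mod c {q * e} {1} qe≡1) qe≡1 ⟩
      c * 1 * 1 % p                ≡⟨ cong (_% p) (trans (*-identityʳ (c * 1)) (*-identityʳ c)) ⟩
      c % p                        ∎)
      where
      open ≡-Reasoning
      interchange : ∀ s e → s * e * (s * e) ≡ s * s * (e * e)
      interchange = solve-∀
      regroup : ∀ c q e → c * (q * q) * (e * e) ≡ c * (q * e) * (q * e)
      regroup = solve-∀

  legendre-^-odd : ∀ a j → legendre (a ^ suc (2 * j)) p ≡ legendre a p
  legendre-^-odd a j = legendre-cong (a ^ suc (2 * j)) a
    (mk⇔ (prime∣^⇒prime∣ a (suc (2 * j)) prime) p∣a⇒p∣aᵒ)
    (λ p∤aᵒ → isSquareMod-^-odd a j (p∤aᵒ ∘ p∣a⇒p∣aᵒ))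
    where
    p∣a⇒p∣aᵒ : p ∣ a → p ∣ a ^ suc (2 * j)
    p∣a⇒p∣aᵒ = ∣m⇒∣m*n (a ^ (2 * j))

%2≢0⇒%2≡1 : ∀ m → m % 2 ≢ 0 → m % 2 ≡ 1
%2≢0⇒%2≡1 m m%2≢0 with m % 2 | m%n<n m 2
... | zero        | _ = ⊥-elim (m%2≢0 refl)
... | suc zero    | _ = refl
... | suc (suc _) | s≤s (s≤s ())

ν₂-aux-odd-part : ∀ f t → t ≤ f → 0 < t → ∃[ o ] t ≡ 2 ^ ν₂-aux f t * suc (2 * o)
ν₂-aux-odd-part (suc f) (suc t) (s≤s t≤f) _ with suc t % 2 ≟ 0
... | yes even = o , (begin
    suc t                           ≡⟨ t+1≡2h ⟩
    2 * h                           ≡⟨ cong (2 *_) h≡ ⟩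
    2 * (2 ^ ν₂-aux f h * suc (2 * o)) ≡⟨ sym (*-assoc 2 (2 ^ ν₂-aux f h) (suc (2 * o))) ⟩
    2 * 2 ^ ν₂-aux f h * suc (2 * o) ∎)
  where
  open ≡-Reasoning
  h = suc t / 2
  t+1≡2h : suc t ≡ 2 * h
  t+1≡2h = trans (m≡m%n+[m/n]*n (suc t) 2) (trans (cong (_+ h * 2) even) (*-comm h 2))
  h≤f : h ≤ f
  h≤f = ≤-pred (≤-trans (m/n<m (suc t) 2 (s≤s (s≤s z≤n))) (s≤s t≤f))
  0<h : 0 < h
  0<h = n≢0⇒n>0 (λ h≡0 → 1+n≢0 (trans t+1≡2h (cong (2 *_) h≡0)))
  o = proj₁ (ν₂-aux-odd-part f h h≤f 0<h)
  h≡ = proj₂ (ν₂-aux-odd-part f h h≤f 0<h)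
... | no odd = suc t / 2 , (begin
    suc t                              ≡⟨ m≡m%n+[m/n]*n (suc t) 2 ⟩
    suc t % 2 + suc t / 2 * 2          ≡⟨ cong₂ _+_ (%2≢0⇒%2≡1 (suc t) odd) (*-comm (suc t / 2) 2) ⟩
    suc (2 * (suc t / 2))              ≡⟨ sym (+-identityʳ _) ⟩
    1 * suc (2 * (suc t / 2))          ∎)
  where open ≡-Reasoning

ν₂-odd-part : ∀ {t} → 0 < t → ∃[ o ] t ≡ 2 ^ ν₂ t * suc (2 * o)
ν₂-odd-part {t} = ν₂-aux-odd-part t t ≤-refl

ν₂[t]<t : ∀ {t} → 0 < t → ν₂ t < t
ν₂[t]<t {t} 0<t with ν₂-odd-part 0<t
... | o , t≡ = ≤-trans (n<2^n (ν₂ t)) (subst (2 ^ ν₂ t ≤_) (sym t≡) (m≤m*n (2 ^ ν₂ t) (suc (2 * o))))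

infix 4 _≡1[mod2^_] ν₂[_∸1]≡_

data _≡1[mod2^_] : ℕ → ℕ → Set where
  1+2^k* : ∀ {k} q → 1 + 2 ^ k * q ≡1[mod2^ k ]

data ν₂[_∸1]≡_ : ℕ → ℕ → Set where
  1+2^k+2^k+1* : ∀ {k} q → ν₂[ 1 + 2 ^ k + 2 ^ suc k * q ∸1]≡ k

≡1[mod2^]-* : ∀ {k X Y} → X ≡1[mod2^ k ] → Y ≡1[mod2^ k ] → X * Y ≡1[mod2^ k ]
≡1[mod2^]-* {k} (1+2^k* q) (1+2^k* r) = subst (_≡1[mod2^ k ]) (sym (expand (2 ^ k) q r)) (1+2^k* _)
  where
  expand : ∀ h q r → (1 + h * q) * (1 + h * r) ≡ 1 + h * (q + r + h * q * r)
  expand = solve-∀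

≡1[mod2^]-^ : ∀ {k X} → X ≡1[mod2^ k ] → ∀ m → X ^ m ≡1[mod2^ k ]
≡1[mod2^]-^ {k} _   zero    = subst (_≡1[mod2^ k ]) (cong suc (*-zeroʳ (2 ^ k))) (1+2^k* 0)
≡1[mod2^]-^     X≡1 (suc m) = ≡1[mod2^]-* X≡1 (≡1[mod2^]-^ X≡1 m)

ν₂[∸1]-*-≡1 : ∀ {k X Y} → ν₂[ X ∸1]≡ k → Y ≡1[mod2^ suc k ] → ν₂[ X * Y ∸1]≡ k
ν₂[∸1]-*-≡1 {k} (1+2^k+2^k+1* q) (1+2^k* r) =
  subst (ν₂[_∸1]≡ k) (sym (expand (2 ^ k) q r)) (1+2^k+2^k+1* _)
  where
  expand : ∀ h q r → (1 + h + 2 * h * q) * (1 + 2 * h * r)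
                     ≡ 1 + h + 2 * h * (q + r + h * r + 2 * h * q * r)
  expand = solve-∀

-- The valuation must be positive, so that 2^(k+2) divides (2^(k+1))².
ν₂[∸1]-*-ν₂[∸1] : ∀ {k X Y} → ν₂[ X ∸1]≡ suc k → ν₂[ Y ∸1]≡ suc k → X * Y ≡1[mod2^ suc (suc k) ]
ν₂[∸1]-*-ν₂[∸1] {k} (1+2^k+2^k+1* q) (1+2^k+2^k+1* r) =
  subst (_≡1[mod2^ suc (suc k) ]) (sym (expand (2 ^ k) q r)) (1+2^k* _)
  where
  expand : ∀ g q r → (1 + 2 * g + 2 * (2 * g) * q) * (1 + 2 * g + 2 * (2 * g) * r)
                     ≡ 1 + 2 * (2 * g) * (1 + q + r + g * (1 + 2 * q + 2 * r + 4 * q * r))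
  expand = solve-∀

-- Lifting the exponent at 2; valuation ≥ 2 is what makes 2^(k+3) divide (2^(k+2))².
ν₂[∸1]-square : ∀ {k X} → ν₂[ X ∸1]≡ suc (suc k) → ν₂[ X * X ∸1]≡ suc (suc (suc k))
ν₂[∸1]-square {k} (1+2^k+2^k+1* q) =
  subst (ν₂[_∸1]≡ suc (suc (suc k))) (sym (expand (2 ^ k) q)) (1+2^k+2^k+1* _)
  where
  expand : ∀ g q → let h = 2 * (2 * g) in (1 + h + 2 * h * q) * (1 + h + 2 * h * q)
                   ≡ 1 + 2 * h + 2 * (2 * h) * (g + q + h * q + h * q * q)
  expand = solve-∀

ν₂[∸1]-^-odd : ∀ {k X} → ν₂[ X ∸1]≡ suc k → ∀ m → ν₂[ X ^ suc (2 * m) ∸1]≡ suc k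
ν₂[∸1]-^-odd {k} {X} νX m =
  subst (ν₂[_∸1]≡ suc k) (sym (trans (^-odd X m) (cong (X *_) (sym (^-distribʳ-* X X m)))))
  (ν₂[∸1]-*-≡1 νX (≡1[mod2^]-^ (ν₂[∸1]-*-ν₂[∸1] νX νX) m))

ν₂[∸1]-^-2^ : ∀ {k X} → ν₂[ X ∸1]≡ suc (suc k) → ∀ c → ν₂[ X ^ 2 ^ c ∸1]≡ suc (suc (c + k))
ν₂[∸1]-^-2^ {k} {X} νX zero    = subst (ν₂[_∸1]≡ suc (suc k)) (sym (*-identityʳ X)) νX
ν₂[∸1]-^-2^ {k} {X} νX (suc c) = subst (ν₂[_∸1]≡ suc (suc (suc c + k))) (sym (^-2^-suc X c))
  (ν₂[∸1]-square (ν₂[∸1]-^-2^ νX c))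

ν₂[∸1]-^ : ∀ {k X} → ν₂[ X ∸1]≡ suc (suc k) →
           ∀ c m → ν₂[ X ^ (2 ^ c * suc (2 * m)) ∸1]≡ suc (suc (c + k))
ν₂[∸1]-^ {k} {X} νX c m = subst (ν₂[_∸1]≡ suc (suc (c + k))) (^-*-assoc X (2 ^ c) (suc (2 * m)))
  (ν₂[∸1]-^-odd (ν₂[∸1]-^-2^ νX c) m)

≡1[mod2^]-^-2^ : ∀ {k X} → ν₂[ X ∸1]≡ suc (suc k) →
                 ∀ c q → X ^ (2 ^ suc c * q) ≡1[mod2^ suc (suc (suc (c + k))) ]
≡1[mod2^]-^-2^ {k} {X} νX c q = subst (_≡1[mod2^ suc (suc (suc (c + k))) ])
  (trans (cong (_^ q) (sym (^-2^-suc X c))) (^-*-assoc X (2 ^ suc c) q))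
  (≡1[mod2^]-^ (ν₂[∸1]-*-ν₂[∸1] (ν₂[∸1]-^-2^ νX c) (ν₂[∸1]-^-2^ νX c)) q)

ν₂[∸1]≡⇒≢+ : ∀ {k X Y D} → ν₂[ X ∸1]≡ k → Y ≡1[mod2^ suc k ] → 2 ^ suc k ∣ D → X ≢ Y + D
ν₂[∸1]≡⇒≢+ {k} (1+2^k+2^k+1* q) (1+2^k* r) (divides d refl) eq =
  even≢odd (r + d) q (sym (*-cancelˡ-≡ _ _ (2 ^ k) {{m^n≢0 2 k}} (suc-injective (begin
    1 + 2 ^ k * (1 + 2 * q)             ≡⟨ odd-form (2 ^ k) q ⟩
    1 + 2 ^ k + 2 ^ suc k * q           ≡⟨ eq ⟩
    1 + 2 ^ suc k * r + d * 2 ^ suc k   ≡⟨ even-form (2 ^ k) r d ⟩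
    1 + 2 ^ k * (2 * (r + d))           ∎))))
  where
  open ≡-Reasoning
  odd-form : ∀ h q → 1 + h * (1 + 2 * q) ≡ 1 + h + 2 * h * q
  odd-form = solve-∀
  even-form : ∀ h r d → 1 + 2 * h * r + d * (2 * h) ≡ 1 + h * (2 * (r + d))
  even-form = solve-∀

ν₂[x]≤ν₂[z∸x] : ∀ {A B x z k D} → ν₂[ A ∸1]≡ 2 → ν₂[ B ∸1]≡ 2 →
                0 < x → x < z → 2 + z ≤ k → 2 ^ k ∣ D →
                A ^ z ≡ B ^ x + D → ν₂ x ≤ ν₂ (z ∸ x)
ν₂[x]≤ν₂[z∸x] {A} {B} {x} {z} {k} {D} νA νB 0<x x<z 2+z≤k 2ᵏ∣D Aᶻ≡Bˣ+D
  with ν₂-odd-part (m<n⇒0<n∸m x<z) | ν₂-odd-part 0<x | ν₂ x ≤? ν₂ (z ∸ x)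
... | _ | _ | yes b≤a = b≤a
... | d , z∸x≡ | e , x≡2ᵇe | no b≰a =
  ⊥-elim (ν₂[∸1]≡⇒≢+ (ν₂[∸1]-^ νA a d′) (≡1[mod2^]-^-2^ νB a Q)
                     (∣-trans (m^i∣m^j 2 3+a≤k) 2ᵏ∣D) (begin
    A ^ (2 ^ a * suc (2 * d′))   ≡⟨ cong (A ^_) (sym z≡) ⟩
    A ^ z                        ≡⟨ Aᶻ≡Bˣ+D ⟩
    B ^ x + D                    ≡⟨ cong (λ t → B ^ t + D) x≡ ⟩
    B ^ (2 ^ suc a * Q) + D      ∎))
  where
  open ≡-Reasoning
  a = ν₂ (z ∸ x)
  Q = 2 ^ (ν₂ x ∸ suc a) * suc (2 * e)
  d′ = d + Q
  x≡ : x ≡ 2 ^ suc a * Q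
  x≡ = trans x≡2ᵇe (^-*-split 2 (suc (2 * e)) (≰⇒> b≰a))
  z≡ : z ≡ 2 ^ a * suc (2 * d′)
  z≡ = begin
    z                                     ≡⟨ sym (m∸n+n≡m (<⇒≤ x<z)) ⟩
    (z ∸ x) + x                           ≡⟨ cong₂ _+_ z∸x≡ x≡ ⟩
    2 ^ a * suc (2 * d) + 2 ^ suc a * Q   ≡⟨ factor (2 ^ a) d Q ⟩
    2 ^ a * suc (2 * (d + Q))             ∎
    where
    factor : ∀ h d Q → h * (1 + 2 * d) + 2 * h * Q ≡ h * (1 + 2 * (d + Q))
    factor = solve-∀
  a<z : a + 0 < z
  a<z = subst (_< z) (sym (+-identityʳ a)) (<-≤-trans (ν₂[t]<t (m<n⇒0<n∸m x<z)) (m∸n≤m z x))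
  3+a≤k : 3 + (a + 0) ≤ k
  3+a≤k = ≤-trans (s≤s (s≤s a<z)) 2+z≤k

%8≡5⇒ν₂[∸1]≡2 : ∀ {X} → X % 8 ≡ 5 → ν₂[ X ∸1]≡ 2
%8≡5⇒ν₂[∸1]≡2 {X} X%8≡5 = subst (ν₂[_∸1]≡ 2) (sym X≡) (1+2^k+2^k+1* (X / 8))
  where
  X≡ : X ≡ 5 + 8 * (X / 8)
  X≡ = trans (m≡m%n+[m/n]*n X 8) (cong₂ _+_ X%8≡5 (*-comm (X / 8) 8))

-- With u = 1 + 2(r + 2t) and r ∈ {0, 1}, u² + 4 is 5 + 8(t + 2t²) or 5 + 8(1 + 3t + 2t²).
odd⇒ν₂[m²+4∸1]≡2 : ∀ {u} → u % 2 ≡ 1 → ν₂[ u ^ 2 + 4 ∸1]≡ 2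
odd⇒ν₂[m²+4∸1]≡2 {u} u%2≡1 =
  subst (λ m → ν₂[ m ^ 2 + 4 ∸1]≡ 2) (sym u≡) (for-u≡1+2[r+2t] (v % 2) (v / 2) (m%n<n v 2))
  where
  v = u / 2
  u≡ : u ≡ 1 + (v % 2 + v / 2 * 2) * 2
  u≡ = trans (m≡m%n+[m/n]*n u 2) (cong₂ _+_ u%2≡1 (cong (_* 2) (m≡m%n+[m/n]*n v 2)))
  for-u≡1+2[r+2t] : ∀ r t → r < 2 → ν₂[ (1 + (r + t * 2) * 2) ^ 2 + 4 ∸1]≡ 2
  for-u≡1+2[r+2t] 0 t _ = subst (ν₂[_∸1]≡ 2) (sym (expand t)) (1+2^k+2^k+1* (t + 2 * t * t))
    where
    expand : ∀ t → (1 + (0 + t * 2) * 2) * ((1 + (0 + t * 2) * 2) * 1) + 4 ≡ 5 + 8 * (t + 2 * t * t)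
    expand = solve-∀
  for-u≡1+2[r+2t] 1 t _ = subst (ν₂[_∸1]≡ 2) (sym (expand t)) (1+2^k+2^k+1* (1 + 3 * t + 2 * t * t))
    where
    expand : ∀ t → (1 + (1 + t * 2) * 2) * ((1 + (1 + t * 2) * 2) * 1) + 4
                   ≡ 5 + 8 * (1 + 3 * t + 2 * t * t)
    expand = solve-∀
  for-u≡1+2[r+2t] (suc (suc _)) _ (s≤s (s≤s ()))

2^[y+y]∣[4u]^y*m : ∀ u y m → 2 ^ (y + y) ∣ (4 * u) ^ y * m
2^[y+y]∣[4u]^y*m u y m = ∣m⇒∣m*n m (divides (u ^ y) (begin
  (4 * u) ^ y           ≡⟨ ^-distribʳ-* 4 u y ⟩
  4 ^ y * u ^ y         ≡⟨ cong (_* u ^ y) (^-*-assoc 2 2 y) ⟩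
  2 ^ (2 * y) * u ^ y   ≡⟨ cong (λ k → 2 ^ (y + k) * u ^ y) (+-identityʳ y) ⟩
  2 ^ (y + y) * u ^ y   ≡⟨ *-comm (2 ^ (y + y)) (u ^ y) ⟩
  u ^ y * 2 ^ (y + y)   ∎))
  where open ≡-Reasoning

^-2^-cancel : ∀ n w {a b s} d e → s + b ≡ a →
              n ^ (2 ^ a * d) ≡ (w ^ 2 ^ s) ^ (2 ^ b * e) → n ^ d ≡ w ^ e
^-2^-cancel n w {a} {b} {s} d e s+b≡a eq = ^-injectiveˡ (2 ^ a) {{m^n≢0 2 a}} (begin
  (n ^ d) ^ 2 ^ a               ≡⟨ ^-*-assoc n d (2 ^ a) ⟩
  n ^ (d * 2 ^ a)               ≡⟨ cong (n ^_) (*-comm d (2 ^ a)) ⟩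
  n ^ (2 ^ a * d)               ≡⟨ eq ⟩
  (w ^ 2 ^ s) ^ (2 ^ b * e)     ≡⟨ ^-*-assoc w (2 ^ s) (2 ^ b * e) ⟩
  w ^ (2 ^ s * (2 ^ b * e))     ≡⟨ cong (w ^_) (sym (*-assoc (2 ^ s) (2 ^ b) e)) ⟩
  w ^ (2 ^ s * 2 ^ b * e)       ≡⟨ cong (λ t → w ^ (t * e)) (sym (^-distribˡ-+-* 2 s b)) ⟩
  w ^ (2 ^ (s + b) * e)         ≡⟨ cong (λ t → w ^ (2 ^ t * e)) s+b≡a ⟩
  w ^ (2 ^ a * e)               ≡⟨ cong (w ^_) (*-comm (2 ^ a) e) ⟩
  w ^ (e * 2 ^ a)               ≡⟨ sym (^-*-assoc w e (2 ^ a)) ⟩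
  (w ^ e) ^ 2 ^ a               ∎)
  where open ≡-Reasoning

lemma5p1 : (u x y z n u₁ u₂ w : ℕ) →
    Prime u → u % 2 ≡ 1 →
    0 < x → 0 < y → 0 < z → 0 < n →
    ((((u ^ 2) ∸ 4) * n) ^ x) + ((4 * u * n) ^ y) ≡ (((u ^ 2) + 4) * n) ^ z →
    1 < n → ¬ ((x ≡ 2) × (y ≡ 2) × (z ≡ 2)) →
    x < z → z < y →
    0 < u₁ → 0 < u₂ → Coprime u₁ u₂ → u₁ * u₂ ≡ (u ^ 2) ∸ 4 →
    ((u ^ 2) + 4) ^ z ≡ (u₁ ^ x) + ((4 * u) ^ y) * (n ^ (y ∸ z)) →
    n ^ (z ∸ x) ≡ u₂ ^ x →
    u₁ % 8 ≡ 5 →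
    0 < w → u₂ ≡ w ^ (2 ^ (ν₂ (z ∸ x) ∸ ν₂ x)) →
    (p : ℕ) → (pp : Prime p) → p % 2 ≡ 1 →
    legendre n p {{prime⇒nonZero pp}} ≡ legendre w p {{prime⇒nonZero pp}}
lemma5p1 u x y z n u₁ u₂ w _ u-odd 0<x _ 0<z _ _ _ _ x<z z<y _ _ _ _
         eqU eqN u₁%8≡5 _ u₂≡w^ p p-prime _
  with ν₂-odd-part (m<n⇒0<n∸m x<z) | ν₂-odd-part 0<x
... | d , z∸x≡ | e , x≡ = begin
  legendre n p                    ≡⟨ sym (legendre-^-odd p-prime n d) ⟩
  legendre (n ^ suc (2 * d)) p    ≡⟨ cong (λ m → legendre m p) nᵈ≡wᵉ ⟩
  legendre (w ^ suc (2 * e)) p    ≡⟨ legendre-^-odd p-prime w e ⟩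
  legendre w p                    ∎
  where
  open ≡-Reasoning
  instance
    p≢0 : NonZero p
    p≢0 = prime⇒nonZero p-prime
  ν₂x≤ν₂[z∸x] : ν₂ x ≤ ν₂ (z ∸ x)
  ν₂x≤ν₂[z∸x] = ν₂[x]≤ν₂[z∸x] (odd⇒ν₂[m²+4∸1]≡2 {u} u-odd) (%8≡5⇒ν₂[∸1]≡2 u₁%8≡5) 0<x x<z
    (+-mono-≤ (≤-trans (s≤s 0<z) z<y) (<⇒≤ z<y)) (2^[y+y]∣[4u]^y*m u y (n ^ (y ∸ z))) eqU
  nᵈ≡wᵉ : n ^ suc (2 * d) ≡ w ^ suc (2 * e)
  nᵈ≡wᵉ = ^-2^-cancel n w {b = ν₂ x} {s = ν₂ (z ∸ x) ∸ ν₂ x} (suc (2 * d)) (suc (2 * e))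
    (m∸n+n≡m ν₂x≤ν₂[z∸x]) (begin
    n ^ (2 ^ ν₂ (z ∸ x) * suc (2 * d))   ≡⟨ cong (n ^_) (sym z∸x≡) ⟩
    n ^ (z ∸ x)                          ≡⟨ eqN ⟩
    u₂ ^ x                               ≡⟨ cong₂ _^_ u₂≡w^ x≡ ⟩
    (w ^ 2 ^ (ν₂ (z ∸ x) ∸ ν₂ x)) ^ (2 ^ ν₂ x * suc (2 * e))   ∎)
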